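{- Let $G=(S,A_1,A_2,\to,\mathit{Goal})$ be a GLTS and $St$ a stable reduction. A state $s\in S$ is winning for player $1$ in $G$ if and only if $s$ is winning for player $1$ in the reduced game $G_{St}$.
   Context: A GLTS is a tuple $G=(S,A_1,A_2,\to,\mathit{Goal})$ with $S$ a set of states, $A_1$ (player 1) and $A_2$ (player 2) finite disjoint action sets, $A=A_1\cup A_2$, $\to\subseteq S\times A\times S$ deterministic (if $(s,a,s'),(s,a,s'')\in\to$ then $s'=s''$), and $\mathit{Goal}\subseteq S$ the goal states. Write $s\xrightarrow{a}s'$ for $(s,a,s')\in\to$, and for $w=a_1\cdots a_n$, $s\xrightarrow{w}s'$ for a chain of such steps. $en_i(s)=\{a\in A_i\mid\exists s'.\,s\xrightarrow{a}s'\}$, $en(s)=en_1(s)\cup en_2(s)$. A run from $s$ is a finite or infinite state sequence $\pi_0\pi_1\cdots$ with $\pi_0=s$ and consecutive states connected by transitions; it is maximal if infinite or its last state $s'$ has $en(s')=\emptyset$. A strategy is $\sigma:S\to A_1\cup\{\bot\}$ with $\sigma(s)\in en_1(s)$ if $en_1(s)\neq\emptyset$, else $\sigma(s)=\bot$. $\mathit{Next}_\sigma(s)=en_2(s)\cup\{\sigma(s)\}$ if $\sigma(s)\ne\bot$, else $en_2(s)$. $\sigma$ is winning at $s$ if every maximal run from $s$ in which each step from $\pi_{i-1}$ uses an action of $\mathit{Next}_\sigma(\pi_{i-1})$ visits a state of $\mathit{Goal}$; $s$ is winning (for player 1) if a winning strategy at $s$ exists. A reduction is a function $St:S\to 2^A$,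 with $\overline{St(s)}=A\setminus St(s)$. The reduced game $G_{St}=(S,A_1,A_2,\to_{St},\mathit{Goal})$ has $s\xrightarrow{a}_{St}s'$ iff $s\xrightarrow{a}s'$ and $a\in St(s)$ (enabled sets, strategies, runs and winning are taken w.r.t. $\to_{St}$ there). For each $s$ fix an interesting set $I(s,\mathit{Goal})\subseteq A$: whenever $s\notin\mathit{Goal}$, $s\xrightarrow{a_1\cdots a_n}s'\in\mathit{Goal}$, some $a_i\in I(s,\mathit{Goal})$. For $s$ with $en_2(s)=\emptyset$, an action $a\in en_1(s)$ is safe in $s$ if whenever $w\in(A_1\setminus\{a\})^*$ with $s\xrightarrow{w}s'$, $en_2(s')=\emptyset$ and $s\xrightarrow{aw}s''$, then $en_2(s'')=\emptyset$; $\mathit{safe}(s)$ is the set of safe actions in $s$. $St$ is stable if for every $s\in S$: (I) if $en_1(s)\ne\emptyset$ and $en_2(s)\ne\emptyset$ then $en(s)\subseteq St(s)$; (W) for all $w\in\overline{St(s)}^*$ and $a\in St(s)$, if $s\xrightarrow{wa}s'$ then $s\xrightarrow{aw}s'$; (R) $I(s,\mathit{Goal})\subseteq St(s)$; (G1) for all $w\in\overline{St(s)}^*$, if $en_2(s)=\emptyset$ and $s\xrightarrow{w}s'$ then $en_2(s')=\emptyset$; (G2) for all $w\in\overline{St(s)}^*$, if $en_1(s)=\emptyset$ and $s\xrightarrow{w}s'$ then $en_1(s')=\emptyset$; (S) $en_1(s)\cap St(s)\subseteq\mathit{safe}(s)$ or $en_1(s)\subseteq St(s)$; (V) if there is $w\in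 A_2^*$ with $s\xrightarrow{w}s'$ and $s'\in\mathit{Goal}$ then $en_2(s)\subseteq St(s)$; (D) if $en_2(s)\ne\emptyset$ then there is $a\in en_2(s)\cap St(s)$ such that for all $w\in\overline{St(s)}^*$ with $s\xrightarrow{w}s'$ we have $a\in en_2(s')$. -}

module Defs where

open import Level using (0ℓ)
open import Data.Nat using (ℕ; zero; suc; _<_; _≤_)
open import Data.Fin using (Fin)
open import Data.Maybe using (Maybe; just; nothing)
open import Data.Sum using (_⊎_; inj₁; inj₂)
open import Data.Product using (Σ; ∃; ∃-syntax; _×_; _,_; proj₁)
open import Data.List using (List; []; _∷_; _++_; [_]; map)
open import Data.List.Relation.Unary.All using (All)
open import Data.List.Relation.Unary.Any using (Any)
open import Relation.Nullary using (¬_)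
open import Relation.Binary.PropositionalEquality using (_≡_; _≢_)
open import Function.Bundles using (_↔_)

Finite : Set → Set
Finite X = ∃[ n ] (X ↔ Fin n)

record GLTS : Set₁ where
  field
    S  : Set
    A₁ : Set
    A₂ : Set
    A₁-finite : Finite A₁
    A₂-finite : Finite A₂
    Step : S → A₁ ⊎ A₂ → S → Set
    deterministic : ∀ {s a s′ s″} → Step s a s′ → Step s a s″ → s′ ≡ s″
    Goal : S → Set

  Act : Set
  Act = A₁ ⊎ A₂


reduce : (G : GLTS) → (GLTS.S G → GLTS.Act G → Set) → GLTS
reduce G St = record
  { S = GLTS.S G ; A₁ = GLTS.A₁ G ; A₂ = GLTS.A₂ G
  ; A₁-finite = GLTS.A₁-finite G ; A₂-finite = GLTS.A₂-finite G
  ; Step = λ s a s′ → GLTS.Step G s a s′ × St s a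
  ; deterministic = λ p q → GLTS.deterministic G (proj₁ p) (proj₁ q)
  ; Goal = GLTS.Goal G }

module Game (G : GLTS) where
  open GLTS G using (S; A₁; A₂; Act; Step; Goal)

  En : S → Act → Set
  En s a = ∃[ s′ ] Step s a s′

  En₁ : S → A₁ → Set
  En₁ s a = En s (inj₁ a)

  En₂ : S → A₂ → Set
  En₂ s b = En s (inj₂ b)

  NoEn₂ : S → Set
  NoEn₂ s = ∀ b → ¬ En₂ s b

  NoEn₁ : S → Set
  NoEn₁ s = ∀ a → ¬ En₁ s a

  ValidChoice : S → Maybe A₁ → Set
  ValidChoice s (just a) = En₁ s a
  ValidChoice s nothing  = NoEn₁ s

  IsStrategy : (S → Maybe A₁) → Set
  IsStrategy σ = ∀ s → ValidChoice s (σ s)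

  Next : (S → Maybe A₁) → S → Act → Set
  Next σ s (inj₁ a) = σ s ≡ just a
  Next σ s (inj₂ b) = En₂ s b

  StepBy : (S → Maybe A₁) → (ℕ → S) → ℕ → Set
  StepBy σ π i = ∃[ a ] (Next σ (π i) a × Step (π i) a (π (suc i)))

  InfRun : (S → Maybe A₁) → S → (ℕ → S) → Set
  InfRun σ s π = π zero ≡ s × (∀ i → StepBy σ π i)

  -- finite maximal run π₀…πₙ from s compatible with σ (values of π beyond n irrelevant)
  MaxFinRun : (S → Maybe A₁) → S → ℕ → (ℕ → S) → Set
  MaxFinRun σ s n π = π zero ≡ s × (∀ i → i < n → StepBy σ π i) × (∀ a → ¬ En (π n) a)

  WinningStrategyAt : (S → Maybe A₁) → S → Set
  WinningStrategyAt σ s =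
      (∀ π → InfRun σ s π → ∃[ i ] Goal (π i))
    × (∀ n π → MaxFinRun σ s n π → ∃[ i ] (i ≤ n × Goal (π i)))

  Winning : S → Set
  Winning s = ∃[ σ ] (IsStrategy σ × WinningStrategyAt σ s)

  data Path : S → List Act → S → Set where
    []  : ∀ {s} → Path s [] s
    _∷_ : ∀ {s a t w u} → Step s a t → Path t w u → Path s (a ∷ w) u

  IsInteresting : (S → Act → Set) → Set
  IsInteresting I = ∀ s w s′ → ¬ Goal s → Path s w s′ → Goal s′ → Any (I s) w

  Safe : S → A₁ → Set
  Safe s a = NoEn₂ s × En₁ s a ×
    (∀ (w : List A₁) → All (_≢ a) w → ∀ s′ s″ →
       Path s (map inj₁ w) s′ → NoEn₂ s′ → Path s (inj₁ a ∷ map inj₁ w) s″ → NoEn₂ s″)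

  module _ (I : S → Act → Set) (St : S → Act → Set) where
    Off : S → List Act → Set
    Off s w = All (λ a → ¬ St s a) w

    record Stable : Set where
      field
        condI : ∀ s → (∃[ a ] En₁ s a) → (∃[ b ] En₂ s b) → ∀ a → En s a → St s a
        condW : ∀ s w a s′ → Off s w → St s a → Path s (w ++ [ a ]) s′ → Path s (a ∷ w) s′
        condR : ∀ s a → I s a → St s a
        condG1 : ∀ s w s′ → Off s w → NoEn₂ s → Path s w s′ → NoEn₂ s′
        condG2 : ∀ s w s′ → Off s w → NoEn₁ s → Path s w s′ → NoEn₁ s′
        condS : ∀ s → (∀ a → En₁ s a → St s (inj₁ a) → Safe s a)
                    ⊎ (∀ a → En₁ s a → St s (inj₁ a))
        condV : ∀ s → (∃[ w ] ∃[ s′ ] (Path s (map inj₂ w) s′ × Goal s′))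
                    → ∀ b → En₂ s b → St s (inj₂ b)
        condD : ∀ s → (∃[ b ] En₂ s b) →
                  ∃[ b ] (En₂ s b × St s (inj₂ b) ×
                    (∀ w s′ → Off s w → Path s w s′ → En₂ s′ b))

module Submission where

-- The proof works with attractor ranks instead of strategies.  A state has
-- rank n if player 1 can force a visit to Goal within n moves by one choice
-- per state; a state is "rank-winning" if it has some rank.
--
-- For ⇒ player 1
--    plays the choice of a least-rank witness, so ranks decrease along every
--    compatible run; for ⇐ a losing state lets the opponent stay among losing
--    states forever or until a dead end.  Finiteness of the action sets makes
--    the ranks of all successors boundedly many.
-- 3. Module Reduction: rank-winning in G ⇔ rank-winning in G_St, by
--    induction on the rank.  The two hard cases are the paper's: a quiet
--    player-1 state uses (S), (W), (G1) and safety to find a winning move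
--    inside St; an opponent state with a pruned move uses (V), (D), (W), (G2).

open import Defs
open import Level using (0ℓ)
open import Axiom.ExcludedMiddle using (ExcludedMiddle)
open import Axiom.DoubleNegationElimination using (em⇒dne)
open import Data.Nat using (ℕ; zero; suc; _<_; _≤_; _+_; _⊔_; z≤n; s≤s)
open import Data.Nat.Properties
  using (m≤m⊔n; m≤n⊔m; ≮⇒≥; ≤-pred; m≤n⇒m<n∨m≡n; +-assoc)
open import Data.Nat.Induction using (<-rec)
open import Data.Fin using (Fin)
open import Data.Fin.Properties using (+↔⊎)
open import Data.Maybe using (Maybe; just; nothing)
open import Data.Sum using (_⊎_; inj₁; inj₂)
open import Data.Sum.Function.Propositional using (_⊎-↔_)
open import Data.Product using (Σ; ∃; _×_; _,_; proj₁; proj₂)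
open import Data.Empty using (⊥-elim)
open import Data.List using (List; []; _∷_; _++_; [_]; map; length)
open import Data.List.Properties using (length-++)
open import Data.List.Relation.Unary.All using (All; []; _∷_)
import Data.List.Relation.Unary.All.Properties as AllP
import Data.List.Relation.Unary.Any as Any
open import Relation.Nullary using (¬_; Dec; yes; no)
open import Relation.Binary.PropositionalEquality
  using (_≡_; refl; sym; trans; subst; cong)
open import Function using (_∘_)
open import Function.Bundles using (_⇔_; mk⇔; Inverse)
open import Function.Properties.Inverse using (↔-trans; ↔-sym)
import Function.Properties.Equivalence as ⇔

UpClosed : (ℕ → Set) → Set
UpClosed Q = ∀ {m n} → m ≤ n → Q m → Q n

commonBound-Fin : ∀ k (Q : Fin k → ℕ → Set) → (∀ i → UpClosed (Q i)) →
                  (∀ i → ∃ (Q i)) → ∃ λ N → ∀ i → Q i N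
commonBound-Fin zero    Q up ex = zero , λ ()
commonBound-Fin (suc k) Q up ex
  with ex Fin.zero | commonBound-Fin k (Q ∘ Fin.suc) (up ∘ Fin.suc) (ex ∘ Fin.suc)
... | n₀ , q₀ | N , qN = n₀ ⊔ N , λ
  { Fin.zero    → up Fin.zero (m≤m⊔n n₀ N) q₀
  ; (Fin.suc i) → up (Fin.suc i) (m≤n⊔m n₀ N) (qN i) }

commonBound : {X : Set} → Finite X → (Q : X → ℕ → Set) → (∀ x → UpClosed (Q x)) →
              (∀ x → ∃ (Q x)) → ∃ λ N → ∀ x → Q x N
commonBound (k , X↔Fin) Q up ex =
  proj₁ common , λ x → subst (λ y → Q y (proj₁ common)) (strictlyInverseʳ x) (proj₂ common (to x))
  where
    open Inverse X↔Fin using (to; from; strictlyInverseʳ)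
    common : ∃ λ N → ∀ i → Q (from i) N
    common = commonBound-Fin k (Q ∘ from) (up ∘ from) (ex ∘ from)

Finite-⊎ : {A B : Set} → Finite A → Finite B → Finite (A ⊎ B)
Finite-⊎ (m , A↔Fin) (n , B↔Fin) = m + n , ↔-trans (A↔Fin ⊎-↔ B↔Fin) (↔-sym +↔⊎)

Least : (ℕ → Set) → ℕ → Set
Least P m = P m × (∀ {k} → k < m → ¬ P k)

least : ExcludedMiddle 0ℓ → (P : ℕ → Set) → ∀ n → P n → ∃ (Least P)
least em P = <-rec (λ n → P n → ∃ (Least P)) step
  where
    step : ∀ n → (∀ {k} → k < n → P k → ∃ (Least P)) → P n → ∃ (Least P)
    step n below pn with em {∃ λ k → k < n × P k}
    ... | yes (k , k<n , pk) = below k<n pk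
    ... | no none            = n , pn , λ k<n pk → none (_ , k<n , pk)

-- Moving one unit of the rank budget k onto the list length.
length-snoc-+ : {X : Set} (u : List X) (x : X) (k : ℕ) →
                length (u ++ [ x ]) + k ≡ length u + suc k
length-snoc-+ u x k = trans (cong (_+ k) (length-++ u)) (+-assoc (length u) 1 k)

module Attractor (em : ExcludedMiddle 0ℓ) (G : GLTS) where
  open GLTS G
  open Game G public

  dne : {P : Set} → ¬ ¬ P → P
  dne = em⇒dne em

  Act-finite : Finite Act
  Act-finite = Finite-⊎ A₁-finite A₂-finite

  Allowed : Maybe A₁ → S → Act → Set
  Allowed c = Next (λ _ → c)

  next⇒allowed : ∀ {σ s} a → Next σ s a → Allowed (σ s) s a
  next⇒allowed (inj₁ _) n = n
  next⇒allowed (inj₂ _) n = n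

  allowed⇒next : ∀ {σ s} a → Allowed (σ s) s a → Next σ s a
  allowed⇒next (inj₁ _) n = n
  allowed⇒next (inj₂ _) n = n

  Forces : Maybe A₁ → S → (S → Set) → Set
  Forces c s P = ∀ a {t} → Allowed c s a → Step s a t → P t

  -- Attr n s: player 1 can force a visit to Goal from s within n moves.
  -- A non-goal state needs some enabled move, since dead ends are losing.
  Attr : ℕ → S → Set
  Attr zero    s = Goal s
  Attr (suc n) s = Goal s ⊎ Σ (Maybe A₁) λ c →
                     ValidChoice s c × ∃ (En s) × Forces c s (Attr n)

  Win : S → Set
  Win s = ∃ λ n → Attr n s

  goal⇒Attr : ∀ n {s} → Goal s → Attr n s
  goal⇒Attr zero    g = g
  goal⇒Attr (suc n) g = inj₁ g

  Attr-mono : ∀ {m n s} → m ≤ n → Attr m s → Attr n s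
  Attr-mono {n = n} z≤n g              = goal⇒Attr n g
  Attr-mono (s≤s m≤n) (inj₁ g)         = inj₁ g
  Attr-mono (s≤s m≤n) (inj₂ (c , v , e , h)) =
    inj₂ (c , v , e , λ a nx st → Attr-mono m≤n (h a nx st))

  -- If some move is enabled and every move allowed by a legal choice reaches
  -- a winning state, s is winning: by determinism and finiteness of Act the
  -- successors have boundedly many ranks.
  Win-closed : ∀ {s} c → ValidChoice s c → ∃ (En s) → Forces c s Win → Win s
  Win-closed {s} c v e h = suc (proj₁ common) , inj₂ (c , v , e , λ a → proj₂ common a)
    where
      RankBound : Act → ℕ → Set
      RankBound a n = ∀ {t} → Allowed c s a → Step s a t → Attr n t
      rankOf : ∀ a → ∃ (RankBound a)
      rankOf a with em {∃ λ t → Allowed c s a × Step s a t}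
      ... | no none = zero , λ nx st → ⊥-elim (none (_ , nx , st))
      ... | yes (t , nx , st) with h a nx st
      ...   | n , w = n , λ _ st′ → subst (Attr n) (deterministic st st′) w
      common : ∃ λ N → ∀ a → RankBound a N
      common = commonBound Act-finite RankBound
                 (λ a m≤n bound nx st → Attr-mono m≤n (bound nx st)) rankOf

  -- At a state without opponent moves, a player-1 move into rank n is
  -- forced by determinism and gives rank n + 1; conversely a non-goal state
  -- of rank n + 1 has such a move.
  Attr-push₁ : ∀ {q x r} n → NoEn₂ q → Step q (inj₁ x) r → Attr n r → Attr (suc n) q
  Attr-push₁ {q} {x} {r} n quiet st w =
    inj₂ (just x , (_ , st) , (inj₁ x , _ , st) , forced)
    where
      forced : Forces (just x) q (Attr n)
      forced (inj₁ _) refl st′ = subst (Attr n) (deterministic st st′) w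
      forced (inj₂ y) en   _   = ⊥-elim (quiet y en)

  Attr-pop₁ : ∀ {p} n → NoEn₂ p → ¬ Goal p → Attr (suc n) p →
              Σ A₁ λ a → Σ S λ p′ → Step p (inj₁ a) p′ × Attr n p′
  Attr-pop₁ _ quiet ng (inj₁ g) = ⊥-elim (ng g)
  Attr-pop₁ _ quiet ng (inj₂ (just a , (p′ , st) , _ , h))        = a , p′ , st , h (inj₁ a) refl st
  Attr-pop₁ _ quiet ng (inj₂ (nothing , noEn₁ , (inj₁ a , e) , _)) = ⊥-elim (noEn₁ a e)
  Attr-pop₁ _ quiet ng (inj₂ (nothing , _ , (inj₂ b , e) , _))     = ⊥-elim (quiet b e)

  Attr-pop₂ : ∀ {p y q} n → ¬ Goal p → Attr (suc n) p → Step p (inj₂ y) q → Attr n q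
  Attr-pop₂ _ ng (inj₁ g)               _  = ⊥-elim (ng g)
  Attr-pop₂ _ ng (inj₂ (_ , _ , _ , h)) st = h (inj₂ _) (_ , st) st

  GoalFree₂ : S → Set
  GoalFree₂ p = ∀ w {q} → Path p (map inj₂ w) q → ¬ Goal q

  Win-along₂ : ∀ {p q} w → GoalFree₂ p → Win p → Path p (map inj₂ w) q → Win q
  Win-along₂ []      free win            []            = win
  Win-along₂ (y ∷ w) free (zero , g)     _             = ⊥-elim (free [] [] g)
  Win-along₂ (y ∷ w) free (suc n , rank) (st ∷ path) =
    Win-along₂ w (λ w′ path′ → free (y ∷ w′) (st ∷ path′)) (n , Attr-pop₂ n (free [] []) rank st) path

  -- The positional strategy σ*: at a rank-winning state play the choice of a
  -- least-rank witness, elsewhere any legal choice.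
  anyChoice : ∀ t → Σ (Maybe A₁) (ValidChoice t)
  anyChoice t with em {∃ (En₁ t)}
  ... | yes (a , e) = just a , e
  ... | no none     = nothing , λ a e → none (a , e)

  leastChoice : ∀ t → ∃ (Least (λ n → Attr n t)) → Σ (Maybe A₁) (ValidChoice t)
  leastChoice t (zero  , _ , _)                = anyChoice t
  leastChoice t (suc m , inj₁ _ , _)           = anyChoice t
  leastChoice t (suc m , inj₂ (c , v , _) , _) = c , v

  optimalChoice : ∀ t → Dec (Win t) → Σ (Maybe A₁) (ValidChoice t)
  optimalChoice t (yes (n , w)) = leastChoice t (least em (λ k → Attr k t) n w)
  optimalChoice t (no _)        = anyChoice t

  σ* : S → Maybe A₁
  σ* t = proj₁ (optimalChoice t em)

  σ*-strategy : IsStrategy σ*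
  σ*-strategy t = proj₂ (optimalChoice t em)

  Progress : Maybe A₁ → S → ℕ → Set
  Progress c t n = Goal t ⊎ (∃ (En t) × Forces c t (Attr n))

  leastChoice-progress : ∀ t n r → Attr (suc n) t → Progress (proj₁ (leastChoice t r)) t n
  leastChoice-progress t n (zero  , g , _)      _ = inj₁ g
  leastChoice-progress t n (suc m , inj₁ g , _) _ = inj₁ g
  leastChoice-progress t n (suc m , inj₂ (c , v , e , h) , minimal) w =
    inj₂ (e , λ a nx st → Attr-mono m≤n (h a nx st))
    where
      m≤n : m ≤ n
      m≤n = ≤-pred (≮⇒≥ λ n<m → minimal n<m w)

  σ*-progress : ∀ t n → Attr (suc n) t → Progress (σ* t) t n
  σ*-progress t n = progress em
    where
      progress : (d : Dec (Win t)) → Attr (suc n) t → Progress (proj₁ (optimalChoice t d)) t n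
      progress (yes (k , w)) = leastChoice-progress t n (least em _ k w)
      progress (no lose) w   = ⊥-elim (lose (suc n , w))

  -- Along a σ*-run the rank drops at each non-goal position, so Goal is hit.
  σ*-infinite : ∀ π → (∀ i → StepBy σ* π i) → ∀ n i → Attr n (π i) → ∃ λ j → Goal (π j)
  σ*-infinite π step zero    i g = i , g
  σ*-infinite π step (suc n) i w with σ*-progress (π i) n w
  ... | inj₁ g = i , g
  ... | inj₂ (_ , h) with step i
  ...   | a , nx , st = σ*-infinite π step n (suc i) (h a (next⇒allowed {σ*} {π i} a nx) st)

  -- A finite maximal σ*-run cannot stop at a non-goal state of positive rank.
  σ*-finite : ∀ π N → (∀ i → i < N → StepBy σ* π i) → (∀ a → ¬ En (π N) a) →
              ∀ n i → i ≤ N → Attr n (π i) → ∃ λ j → j ≤ N × Goal (π j)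
  σ*-finite π N step dead zero    i i≤N g = i , i≤N , g
  σ*-finite π N step dead (suc n) i i≤N w with σ*-progress (π i) n w
  ... | inj₁ g = i , i≤N , g
  ... | inj₂ ((a₀ , e₀) , h) with m≤n⇒m<n∨m≡n i≤N
  ...   | inj₂ refl = ⊥-elim (dead a₀ e₀)
  ...   | inj₁ i<N with step i i<N
  ...     | a , nx , st =
    σ*-finite π N step dead n (suc i) i<N (h a (next⇒allowed {σ*} {π i} a nx) st)

  Win⇒Winning : ∀ {s} → Win s → Winning s
  Win⇒Winning (n , w) = σ* , σ*-strategy ,
    (λ { π (refl , step)        → σ*-infinite π step n zero w }) ,
    (λ { N π (refl , step , dead) → σ*-finite π N step dead n zero z≤n w })

  -- Against a strategy σ from a losing state, the opponent resolves every
  -- position by moving (with σ's or its own action) to a losing state while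
  -- possible.
  module Refutation (σ : S → Maybe A₁) (σ-strategy : IsStrategy σ) where
    Escape : S → Set
    Escape t = Σ Act λ a → Σ S λ t′ → Next σ t a × Step t a t′ × ¬ Win t′

    escapeFrom : ∀ t → Dec (Escape t) → S
    escapeFrom t (yes (_ , t′ , _)) = t′
    escapeFrom t (no _)             = t

    spoil : S → ℕ → S
    spoil s zero    = s
    spoil s (suc i) = escapeFrom (spoil s i) em

    escape-losing : ∀ t d → ¬ Win t → ¬ Win (escapeFrom t d)
    escape-losing t (yes (_ , _ , _ , _ , lose′)) _ = lose′
    escape-losing t (no _)                        lose = lose

    escape-step : ∀ t d → Escape t → ∃ λ a → Next σ t a × Step t a (escapeFrom t d)
    escape-step t (yes (a , _ , nx , st , _)) _ = a , nx , st
    escape-step t (no none)                   e = ⊥-elim (none e)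

    spoil-losing : ∀ {s} → ¬ Win s → ∀ i → ¬ Win (spoil s i)
    spoil-losing lose zero    = lose
    spoil-losing lose (suc i) = escape-losing _ em (spoil-losing lose i)

    -- A losing state without escape is a dead end, else Win-closed applies.
    trapped⇒dead : ∀ {t} → ¬ Win t → ¬ Escape t → ∀ a → ¬ En t a
    trapped⇒dead {t} lose trapped a e = lose (Win-closed (σ t) (σ-strategy t) (a , e)
      λ a′ nx st → dne λ lose′ → trapped (a′ , _ , allowed⇒next {σ} {t} a′ nx , st , lose′))

    -- The spoiling run is σ-compatible and maximal (infinite, or stopping at
    -- the first trapped state), and never visits Goal.
    WinningAt⇒Win : ∀ {s} → WinningStrategyAt σ s → Win s
    WinningAt⇒Win {s} (winInf , winFin) = dne refute
      where
        refute : ¬ ¬ Win s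
        refute lose with em {∃ λ i → ¬ Escape (spoil s i)}
        ... | no escapes with winInf (spoil s) (refl , λ i →
                escape-step (spoil s i) em (dne λ trapped → escapes (i , trapped)))
        ...   | j , g = spoil-losing lose j (zero , g)
        refute lose | yes (i₀ , trapped₀) with least em (λ i → ¬ Escape (spoil s i)) i₀ trapped₀
        ... | i , trapped , earlier with winFin i (spoil s)
                (refl , (λ j j<i → escape-step (spoil s j) em (dne (earlier j<i))) ,
                 trapped⇒dead (spoil-losing lose i) trapped)
        ...   | j , _ , g = spoil-losing lose j (zero , g)

  Winning⇔Win : ∀ s → Winning s ⇔ Win s
  Winning⇔Win s = mk⇔ (λ { (σ , σ-strategy , w) → Refutation.WinningAt⇒Win σ σ-strategy w })
                      Win⇒Winning

module PathFacts (G : GLTS) where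
  open GLTS G
  open Game G

  Path-snoc : ∀ {s w p a q} → Path s w p → Step p a q → Path s (w ++ [ a ]) q
  Path-snoc []          st = st ∷ []
  Path-snoc (st′ ∷ path) st = st′ ∷ Path-snoc path st

  Path-snoc-map : ∀ {X : Set} (f : X → Act) u {x s p q} →
                  Path s (map f u) p → Step p (f x) q → Path s (map f (u ++ [ x ])) q
  Path-snoc-map f []      []           st = st ∷ []
  Path-snoc-map f (_ ∷ u) (st′ ∷ path) st = st′ ∷ Path-snoc-map f u path st

  Path-unsnoc-map : ∀ {X : Set} (f : X → Act) u {x s q} →
                    Path s (map f (u ++ [ x ])) q → ∃ λ p → Path s (map f u) p × Step p (f x) q
  Path-unsnoc-map f []      (st ∷ []) = _ , [] , st
  Path-unsnoc-map f (_ ∷ u) (st ∷ path) with Path-unsnoc-map f u path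
  ... | p , path′ , st′ = p , st ∷ path′ , st′

  Path-functional : ∀ {s w p p′} → Path s w p → Path s w p′ → p ≡ p′
  Path-functional []          []            = refl
  Path-functional (st ∷ path) (st′ ∷ path′) with deterministic st st′
  ... | refl = Path-functional path path′

module Reduction (em : ExcludedMiddle 0ℓ) (G : GLTS)
                 (I : GLTS.S G → GLTS.Act G → Set) (interesting : Game.IsInteresting G I)
                 (St : GLTS.S G → GLTS.Act G → Set) (stable : Game.Stable G I St) where
  open GLTS G
  open Attractor em G
  open Stable stable
  open PathFacts G
  module R = Attractor em (reduce G St)

  Off₁ : S → List A₁ → Set
  Off₁ s = All (λ a → ¬ St s (inj₁ a))

  Off₂ : S → List A₂ → Set
  Off₂ s = All (λ b → ¬ St s (inj₂ b))

  -- By (R) an off-St path carries no interesting action, so it avoids Goal.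
  offPath-avoids-Goal : ∀ {s p} w → ¬ Goal s → Off I St s w → Path s w p → ¬ Goal p
  offPath-avoids-Goal {s} w ng off path g =
    AllP.All¬⇒¬Any off (Any.map (λ {a} → condR s a) (interesting s w _ ng path g))

  reduced⇒allowed : ∀ {c s} a → R.Allowed c s a → Allowed c s a
  reduced⇒allowed (inj₁ _) nx             = nx
  reduced⇒allowed (inj₂ _) (t , st , _) = t , st

  KeptMove : S → ℕ → Set
  KeptMove s n = Σ A₁ λ b → St s (inj₁ b) × Σ S λ t → Step s (inj₁ b) t × Attr n t

  -- At a quiet non-goal state s, follow the winning
  -- player-1 moves outside St(s); they cannot reach Goal, so a move b in
  -- St(s) is met, and by (W) b can be played first and the off-St prefix
  -- afterwards, still forced by safety of b.
  module SafeSearch {s} (quiet : NoEn₂ s) (ng : ¬ Goal s)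
                    (safe : ∀ b → En₁ s b → St s (inj₁ b) → Safe s b) where

    -- Safety of b: after b and then off-St moves, player 2 still cannot move
    -- (the matching states without b are quiet by (G1)).
    delayed-quiet : ∀ {b pre q₀ q} → St s (inj₁ b) → Off₁ s pre →
                    Path s (map inj₁ pre) q₀ → Path s (inj₁ b ∷ map inj₁ pre) q → NoEn₂ q
    delayed-quiet {b} {pre} stb off path₀ path@(st ∷ _) =
      proj₂ (proj₂ (safe b (_ , st) stb)) pre differ _ _ path₀
        (condG1 s _ _ (AllP.map⁺ off) quiet path₀) path
      where
        differ : All (λ a → ¬ a ≡ b) pre
        differ = Data.List.Relation.Unary.All.map
                   (λ nst a≡b → nst (subst (λ a → St s (inj₁ a)) (sym a≡b) stb)) off

    delay : ∀ {b} j v {pre q₀ p q p′} → St s (inj₁ b) → Off₁ s pre → Off₁ s v →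
            Path s (map inj₁ pre) q₀ → Path q₀ (map inj₁ v) p →
            Path s (map inj₁ (b ∷ pre)) q → Path q (map inj₁ v) p′ →
            Attr j p′ → Attr (length v + j) q
    delay j []      stb offPre []             path₀ []           pathB []          w = w
    delay j (x ∷ v) {pre} stb offPre (offx ∷ offv) path₀ (st₀ ∷ rest₀) pathB (st ∷ rest) w =
      Attr-push₁ (length v + j) (delayed-quiet stb offPre path₀ pathB) st
        (delay j v stb (AllP.++⁺ offPre (offx ∷ [])) offv
          (Path-snoc-map inj₁ pre path₀ st₀) rest₀ (Path-snoc-map inj₁ (_ ∷ pre) pathB st) rest w)

    -- Invariant: s -u→ p along off-St moves and p has rank k + 1; the
    -- total budget length u + k shrinks towards the move found.
    search : ∀ k u {p} → Off₁ s u → Path s (map inj₁ u) p → Attr (suc k) p → KeptMove s (length u + k)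
    search k u off path w with Attr-pop₁ k (condG1 s _ _ (AllP.map⁺ off) quiet path)
                                         (offPath-avoids-Goal _ ng (AllP.map⁺ off) path) w
    ... | a , p′ , st , w′ with em {St s (inj₁ a)}
    ...   | yes sta with condW s (map inj₁ u) (inj₁ a) p′ (AllP.map⁺ off) sta (Path-snoc path st)
    ...     | stb ∷ rest = a , sta , _ , stb , delay k u sta [] off [] path (stb ∷ []) rest w′
    search zero u off path w | a , p′ , st , g | no nsta =
      ⊥-elim (offPath-avoids-Goal _ ng (AllP.map⁺ (AllP.++⁺ off (nsta ∷ [])))
                (Path-snoc-map inj₁ u path st) g)
    search (suc k) u off path w | a , p′ , st , w′ | no nsta =
      subst (KeptMove s) (length-snoc-+ u a k)
        (search k (u ++ [ a ]) (AllP.++⁺ off (nsta ∷ [])) (Path-snoc-map inj₁ u path st) w′)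

  quiet-reducedWin : ∀ {s b t} → NoEn₂ s → St s (inj₁ b) → Step s (inj₁ b) t → R.Win t → R.Win s
  quiet-reducedWin {s} {b} quiet stb st win =
    R.Win-closed (just b) (_ , st , stb) (inj₁ b , _ , st , stb) forced
    where
      forced : R.Forces (just b) s R.Win
      forced (inj₁ _) refl (st′ , _) = subst R.Win (deterministic st st′) win
      forced (inj₂ y) (_ , st′ , _) _ = ⊥-elim (quiet y (_ , st′))

  -- At a quiet non-goal state, (S) yields a kept move into the next rank:
  -- the witness's own move if all moves are kept, else one found by search.
  quiet-keptMove : ∀ m {s} → NoEn₂ s → ¬ Goal s → Attr (suc m) s → KeptMove s m
  quiet-keptMove m {s} quiet ng w with condS s
  ... | inj₁ safe = SafeSearch.search quiet ng safe m [] [] [] w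
  ... | inj₂ allSt with Attr-pop₁ m quiet ng w
  ...   | a , t , st , w′ = a , allSt a (t , st) , t , st , w′

  quiet-toReduced : ∀ m {s} → NoEn₂ s → (∀ {t} → Attr m t → R.Win t) → Attr (suc m) s → R.Win s
  quiet-toReduced m {s} quiet IH w with em {Goal s}
  ... | yes g = zero , g
  ... | no ng with quiet-keptMove m quiet ng w
  ...   | b , stb , _ , st , w′ = quiet-reducedWin quiet stb st (IH w′)

  -- At a player-2 state (D) keeps a move enabled,
  -- at a mixed state (I) keeps all moves, quiet states are handled above.
  toReduced-step : ∀ m {s} → (∀ {t} → Attr m t → R.Win t) → Attr (suc m) s → R.Win s
  toReduced-step _ IH (inj₁ g) = zero , g
  toReduced-step _ IH (inj₂ (nothing , noEn₁ , (inj₁ a , e) , _)) = ⊥-elim (noEn₁ a e)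
  toReduced-step _ {s} IH (inj₂ (nothing , noEn₁ , (inj₂ b , e) , h)) with condD s (b , e)
  ... | b′ , (t , st) , stb′ , _ =
    R.Win-closed nothing (λ a (t , st , _) → noEn₁ a (t , st)) (inj₂ b′ , t , st , stb′)
      λ a nx (st , _) → IH (h a (reduced⇒allowed a nx) st)
  toReduced-step m {s} IH w@(inj₂ (just a , (t , st) , _ , h)) with em {∃ (En₂ s)}
  ... | yes en₂ =
    R.Win-closed (just a) (t , st , sta) (inj₁ a , t , st , sta)
      λ a′ nx (st′ , _) → IH (h a′ (reduced⇒allowed a′ nx) st′)
    where
      sta : St s (inj₁ a)
      sta = condI s (a , t , st) en₂ (inj₁ a) (t , st)
  ... | no none₂ = quiet-toReduced m (λ b e → none₂ (b , e)) IH w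

  toReduced : ∀ n {s} → Attr n s → R.Win s
  toReduced zero    g = zero , g
  toReduced (suc m) w = toReduced-step m (toReduced m) w

  -- If St offers player 1 no move but some move exists, then by (I) s is an
  -- opponent state of G.
  reducedOpponent : ∀ {s} → R.NoEn₁ s → ∃ (R.En s) → NoEn₁ s × ∃ (En₂ s)
  reducedOpponent noEn₁ᴿ (inj₁ a , t , st , sta) = ⊥-elim (noEn₁ᴿ a (t , st , sta))
  reducedOpponent noEn₁ᴿ (inj₂ b , t , st , _)   =
    (λ a en → noEn₁ᴿ a (proj₁ en , proj₂ en , condI _ (a , en) (b , t , st) (inj₁ a) en)) ,
    (b , t , st)

  -- By (V) no opponent path reaches
  -- Goal, and (D) gives a move b ∈ St(s) that stays enabled after off-St
  -- opponent moves.  Every off-St play w₂ from s is shadowed by the play b·w₂,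
  -- whose rank bounds the remaining game.
  module PrunedOpponent {s} (noEn₁ : NoEn₁ s)
                        (IH : ∀ {y t} → St s (inj₂ y) → Step s (inj₂ y) t → Win t)
                        {x} (enx : En₂ s x) (offx : ¬ St s (inj₂ x))
                        {b t} (stp : Step s (inj₂ b) t) (stb : St s (inj₂ b))
                        (persist : ∀ w s′ → Off I St s w → Path s w s′ → En₂ s′ b) where

    goalFree : GoalFree₂ s
    goalFree w path g = offx (condV s (w , _ , path , g) x enx)

    -- A St move after w₂ commutes to the front by (W), and its target wins.
    afterSt : ∀ w₂ {y s′ u} → Off₂ s w₂ → St s (inj₂ y) →
              Path s (map inj₂ w₂) s′ → Step s′ (inj₂ y) u → Win u
    afterSt w₂ {y} off sty ps st
      with condW s (map inj₂ w₂) (inj₂ y) _ (AllP.map⁺ off) sty (Path-snoc ps st)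
    ... | st₁ ∷ rest = Win-along₂ w₂ (λ w path → goalFree (y ∷ w) (st₁ ∷ path)) (IH sty st₁) rest

    -- After an off-St move y, b is still enabled and moves to the front by
    -- (W), so the shadow play b·w₂ also advances by y.
    afterOff : ∀ w₂ {y s′ t′ u} → Off₂ s w₂ → ¬ St s (inj₂ y) →
               Path s (map inj₂ w₂) s′ → Path t (map inj₂ w₂) t′ → Step s′ (inj₂ y) u →
               ∃ λ t″ → Step t′ (inj₂ y) t″ × Path t (map inj₂ (w₂ ++ [ y ])) t″
    afterOff w₂ {y} {_} {t′} {u} off nsty ps pt st = shift (persist _ _ off′ ps′)
      where
        off′ : Off I St s (map inj₂ (w₂ ++ [ y ]))
        off′ = AllP.map⁺ (AllP.++⁺ off (nsty ∷ []))
        ps′ : Path s (map inj₂ (w₂ ++ [ y ])) u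
        ps′ = Path-snoc-map inj₂ w₂ ps st
        shift : En₂ u b → ∃ λ t″ → Step t′ (inj₂ y) t″ × Path t (map inj₂ (w₂ ++ [ y ])) t″
        shift (t″ , stB) with condW s _ (inj₂ b) t″ off′ stb (Path-snoc ps′ stB)
        ... | stb′ ∷ rest with deterministic stp stb′
        ...   | refl with Path-unsnoc-map inj₂ w₂ rest
        ...     | _ , pt′ , st′ with Path-functional pt pt′
        ...       | refl = t″ , st′ , rest

    -- Invariant: s -w₂→ s′ and t -w₂→ t′ along off-St moves, t′ of rank k.
    shadow : ∀ k w₂ {s′ t′} → Off₂ s w₂ → Path s (map inj₂ w₂) s′ →
             Path t (map inj₂ w₂) t′ → Attr k t′ → Win s′
    shadow zero    w₂ off ps pt g = ⊥-elim (goalFree (b ∷ w₂) (stp ∷ pt) g)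
    shadow (suc k) w₂ {s′} off ps pt w =
      Win-closed nothing (condG2 s _ _ (AllP.map⁺ off) noEn₁ ps)
                 (inj₂ b , persist _ _ (AllP.map⁺ off) ps) forced
      where
        forced : Forces nothing s′ Win
        forced (inj₁ _) () _
        forced (inj₂ y) _ st with em {St s (inj₂ y)}
        ... | yes sty = afterSt w₂ off sty ps st
        ... | no nsty with afterOff w₂ off nsty ps pt st
        ...   | _ , st′ , pt″ =
          shadow k (w₂ ++ [ y ]) (AllP.++⁺ off (nsty ∷ [])) (Path-snoc-map inj₂ w₂ ps st) pt″
            (Attr-pop₂ k (goalFree (b ∷ w₂) (stp ∷ pt)) w st′)

  opponentTurn : ∀ {s} → NoEn₁ s → ∃ (En₂ s) →
                 (∀ {y t} → St s (inj₂ y) → Step s (inj₂ y) t → Win t) → Win s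
  opponentTurn {s} noEn₁ (b₀ , en₀) IH with em {∃ λ x → En₂ s x × ¬ St s (inj₂ x)}
  ... | no allSt = Win-closed nothing noEn₁ (inj₂ b₀ , en₀) forced
    where
      forced : Forces nothing s Win
      forced (inj₁ _) () _
      forced (inj₂ y) en st = IH (dne λ nst → allSt (y , en , nst)) st
  ... | yes (x , enx , offx) with condD s (b₀ , en₀)
  ...   | b , (t , stp) , stb , persist with IH stb stp
  ...     | n , w = PrunedOpponent.shadow noEn₁ IH enx offx stp stb persist n [] [] [] [] w

  fromReduced-step : ∀ m {s} → (∀ {t} → R.Attr m t → Win t) → R.Attr (suc m) s → Win s
  fromReduced-step _ IH (inj₁ g) = zero , g
  fromReduced-step _ {s} IH (inj₂ (just a , (t , st , sta) , _ , h)) =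
    Win-closed (just a) (t , st) (inj₁ a , t , st) forced
    where
      -- by (I) all opponent moves survive the reduction at this mixed state
      forced : Forces (just a) s Win
      forced (inj₁ _) refl st′ = IH (h (inj₁ a) refl (st′ , sta))
      forced (inj₂ y) en   st′ = IH (h (inj₂ y) (_ , st′ , sty) (st′ , sty))
        where
          sty : St s (inj₂ y)
          sty = condI s (a , t , st) (y , en) (inj₂ y) en
  fromReduced-step _ {s} IH (inj₂ (nothing , noEn₁ᴿ , e , h))
    with reducedOpponent noEn₁ᴿ e
  ... | noEn₁ , en₂ = opponentTurn noEn₁ en₂ λ sty st → IH (h (inj₂ _) (_ , st , sty) (st , sty))

  fromReduced : ∀ n {s} → R.Attr n s → Win s
  fromReduced zero    g = zero , g
  fromReduced (suc m) w = fromReduced-step m (fromReduced m) w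

  Win⇔reducedWin : ∀ s → Win s ⇔ R.Win s
  Win⇔reducedWin s = mk⇔ (λ (n , w) → toReduced n w) (λ (n , w) → fromReduced n w)

theorem3p6 : ExcludedMiddle 0ℓ →
    (G : GLTS) (I : GLTS.S G → GLTS.Act G → Set) → Game.IsInteresting G I →
    (St : GLTS.S G → GLTS.Act G → Set) → Game.Stable G I St →
    (s : GLTS.S G) → Game.Winning G s ⇔ Game.Winning (reduce G St) s
theorem3p6 em G I interesting St stable s =
  ⇔.trans (Full.Winning⇔Win s)
    (⇔.trans (Win⇔reducedWin s) (⇔.sym (Reduced.Winning⇔Win s)))
  where
    module Full    = Attractor em G
    module Reduced = Attractor em (reduce G St)
    open Reduction em G I interesting St stable using (Win⇔reducedWin)
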